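{- Let $k\ge 1$ and let $\tau$ be a pattern (permutation) of length $k+1$. Let $G=(V,E)$ be a graph whose vertices are labeled by distinct elements of a totally ordered set and which is represented by some word avoiding $\tau$. Let $x\in V$ have degree $d(x)\ge k$. Then every word $w$ that represents $G$ and avoids $\tau$ contains at most $k$ occurrences of $x$.
   Context: All graphs are simple; $d(x)$ is the degree of vertex $x$. A word is a finite sequence of letters from a totally ordered alphabet. Two letters $x,y$ alternate in a word $w$ if between any two occurrences of $x$ there is an occurrence of $y$ and between any two occurrences of $y$ there is an occurrence of $x$. A graph $G=(V,E)$ is represented by a word $w$ over $V$ if for all distinct $x,y\in V$, $x$ and $y$ alternate in $w$ if and only if $xy\in E$. A word $w=w_1\cdots w_n$ contains a pattern $\tau=\tau_1\cdots\tau_m$ if some subsequence $w_{i_1}\cdots w_{i_m}$ ($i_1<\dots<i_m$) is order-isomorphic to $\tau$; otherwise it avoids $\tau$. -}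

module Defs where

open import Data.Nat using (ℕ; suc)
open import Data.Bool using (Bool; true; T)
open import Data.Fin using (Fin; _<_; toℕ)
open import Data.Fin.Properties using (_≟_)
open import Data.List using (List; length; lookup; filter; filterᵇ; allFin)
open import Data.Product using (Σ; _×_; ∃)
open import Function using (Injective)
open import Function.Bundles using (_⇔_)
open import Relation.Binary.PropositionalEquality using (_≡_; _≢_)
open import Relation.Nullary using (¬_)

-- A simple graph on the vertex set Fin n (vertices labelled by distinct
-- elements of the totally ordered set Fin n).
record Graph (n : ℕ) : Set where
  field
    adj   : Fin n → Fin n → Bool
    sym   : ∀ x y → adj x y ≡ adj y x
    irrefl : ∀ x → adj x x ≡ Data.Bool.false

open Graph public

Edge : ∀ {n} → Graph n → Fin n → Fin n → Set
Edge G x y = T (adj G x y)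

degree : ∀ {n} → Graph n → Fin n → ℕ
degree {n} G x = length (filterᵇ (adj G x) (allFin n))

Word : ℕ → Set
Word n = List (Fin n)

occ : ∀ {n} → Fin n → Word n → ℕ
occ x w = length (filter (_≟ x) w)

BetweenAny : ∀ {n} (w : Word n) → Fin n → Fin n → Set
BetweenAny w x y =
  ∀ (i j : Fin (length w)) → i < j → lookup w i ≡ x → lookup w j ≡ x →
    ∃ λ (l : Fin (length w)) → (i < l) × (l < j) × (lookup w l ≡ y)

Alternate : ∀ {n} (w : Word n) → Fin n → Fin n → Set
Alternate w x y = BetweenAny w x y × BetweenAny w y x

Represents : ∀ {n} → Word n → Graph n → Set
Represents w G = ∀ x y → x ≢ y → (Alternate w x y ⇔ Edge G x y)

IsPermutation : ∀ {m} → (Fin m → Fin m) → Set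
IsPermutation τ = Injective _≡_ _≡_ τ

Contains : ∀ {n m} → Word n → (Fin m → Fin m) → Set
Contains {m = m} w τ =
  Σ (Fin m → Fin (length w)) λ ι →
    (∀ a b → a < b → ι a < ι b) ×
    (∀ a b → (lookup w (ι a) < lookup w (ι b)) ⇔ (τ a < τ b))

Avoids : ∀ {n m} → Word n → (Fin m → Fin m) → Set
Avoids w τ = ¬ Contains w τ

module Submission where

-- Suppose w represents G, avoids τ, and
-- contains x at least k+1 times, say at positions p₀ < p₁ < … < p_k.  Pick k
-- neighbours of x and sort them together with x: f₀ < f₁ < … < f_k, with
-- f_r = x.  Let j be the index with τ j = r.  Every neighbour y alternates
-- with x in w, so y occurs in each of the k gaps (p_γ, p_{γ+1}).  Read off
-- the letters f_{τ a} for a = 0,…,k: for a ≠ j take an occurrence of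
-- f_{τ a} in gap number punchOut j a (gaps 0,…,j-1 for a < j and gaps
-- j,…,k-1 for a > j), and for a = j take the occurrence of x at p_j.  These
-- positions increase with a, and the letters are order-isomorphic to τ, so
-- w contains τ — a contradiction.

open import Defs hiding (sym)
open import Data.Nat using (ℕ; suc; _≤_)
open import Data.Fin using (Fin)
open import Data.Product using (∃; _×_)

open import Data.Nat using (zero; z≤n; s≤s; _<_)
import Data.Nat.Properties as ℕₚ
open import Data.Fin using (zero; suc; toℕ; inject₁; punchIn; punchOut; cast)
  renaming (_<_ to _<ᶠ_; _≤_ to _≤ᶠ_)
open import Data.Fin.Properties
  using (_≟_; <-cmp; any?; injective⇒≤; punchOut-injective; punchOut-mono-≤;
         punchIn-punchOut; toℕ-injective; toℕ-inject₁; toℕ-cast; cast-involutive)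
open import Data.List using (List; []; _∷_; length; lookup; filter; allFin)
open import Data.List.Properties using (length-tabulate; lookup-tabulate)
open import Data.Vec.Functional using () renaming (_∷_ to _◂_)
open import Data.Product using (Σ; _,_; proj₁; proj₂)
open import Data.Sum using (inj₁; inj₂)
open import Data.Bool using (T; T?)
open import Data.Empty using (⊥-elim)
open import Function using (_∘_; Injective)
open import Function.Bundles using (_⇔_; mk⇔; Equivalence)
open import Relation.Binary.Definitions using (tri<; tri≈; tri>)
open import Relation.Binary.PropositionalEquality
  using (_≡_; _≢_; refl; sym; trans; cong; subst; subst₂)
open import Relation.Nullary using (yes; no)
open import Relation.Unary using (Decidable)

Increasing : ∀ {m n} → (Fin m → Fin n) → Set
Increasing f = ∀ i j → i <ᶠ j → f i <ᶠ f j

increasing⇒monotone : ∀ {m n} {f : Fin m → Fin n} → Increasing f →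
  ∀ {i j} → i ≤ᶠ j → f i ≤ᶠ f j
increasing⇒monotone {f = f} f-inc {i} {j} i≤j with ℕₚ.m≤n⇒m<n∨m≡n i≤j
... | inj₁ i<j = ℕₚ.<⇒≤ (f-inc i j i<j)
... | inj₂ i≡j = ℕₚ.≤-reflexive (cong (toℕ ∘ f) (toℕ-injective i≡j))

increasing-reflects : ∀ {m n} {f : Fin m → Fin n} → Increasing f →
  ∀ {i j} → f i <ᶠ f j → i <ᶠ j
increasing-reflects {f = f} f-inc {i} {j} fi<fj with <-cmp i j
... | tri< i<j _ _ = i<j
... | tri≈ _ refl _ = ⊥-elim (ℕₚ.<-irrefl refl fi<fj)
... | tri> _ _ j<i = ⊥-elim (ℕₚ.<-asym fi<fj (f-inc j i j<i))

◂-increasing : ∀ {m n} {a : Fin n} {f : Fin m → Fin n} →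
  (∀ i → a <ᶠ f i) → Increasing f → Increasing (a ◂ f)
◂-increasing a<f f-inc zero    (suc j) _         = a<f j
◂-increasing a<f f-inc (suc i) (suc j) (s≤s i<j) = f-inc i j i<j

suc-increasing : ∀ {m n} {f : Fin m → Fin n} → Increasing f → Increasing (suc ∘ f)
suc-increasing f-inc i j i<j = s≤s (f-inc i j i<j)

module _ {A : Set} {P : A → Set} (P? : Decidable P) where

  select : (L : List A) {m : ℕ} → m ≤ length (filter P? L) →
    Σ (Fin m → Fin (length L)) λ p → Increasing p × (∀ i → P (lookup L (p i)))
  select []      z≤n = (λ ()) , (λ ()) , (λ ())
  select (a ∷ L) {m} m≤ with P? a
  ... | no _ with select L m≤
  ...   | p , p-inc , p-ok = suc ∘ p , suc-increasing p-inc , p-ok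
  select (a ∷ L) {zero}  _         | yes _  = (λ ()) , (λ ()) , (λ ())
  select (a ∷ L) {suc m} (s≤s m≤) | yes pa with select L m≤
  ... | p , p-inc , p-ok = zero ◂ suc ∘ p , ◂-increasing (λ _ → s≤s z≤n) (suc-increasing p-inc) , ok
    where
    ok : ∀ i → P (lookup (a ∷ L) ((zero ◂ suc ∘ p) i))
    ok zero    = pa
    ok (suc i) = p-ok i

toℕ-lookup-allFin : ∀ n (q : Fin (length (allFin n))) → toℕ (lookup (allFin n) q) ≡ toℕ q
toℕ-lookup-allFin n q = trans (cong toℕ lookup-q) (toℕ-cast eq q)
  where
  eq : length (allFin n) ≡ n
  eq = length-tabulate {n = n} (λ i → i)
  lookup-q : lookup (allFin n) q ≡ cast eq q
  lookup-q = subst (λ q′ → lookup (allFin n) q′ ≡ cast eq q)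
                   (cast-involutive (sym eq) eq q) (lookup-tabulate (λ i → i) (cast eq q))

neighbours : ∀ {n k} (G : Graph n) (x : Fin n) → k ≤ degree G x →
  Σ (Fin k → Fin n) λ g → Increasing g × (∀ i → Edge G x (g i))
neighbours {n} G x k≤deg with select (λ y → T? (adj G x y)) (allFin n) k≤deg
... | p , p-inc , p-adj = (λ i → lookup (allFin n) (p i)) , g-inc , p-adj
  where
  g-inc : Increasing (λ i → lookup (allFin n) (p i))
  g-inc i j i<j = subst₂ _<_ (sym (toℕ-lookup-allFin n (p i))) (sym (toℕ-lookup-allFin n (p j)))
                         (p-inc i j i<j)

neighbour≢ : ∀ {n} (G : Graph n) {x y : Fin n} → Edge G x y → x ≢ y
neighbour≢ G {x} xy refl = subst T (irrefl G x) xy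

insert : ∀ {k n} (g : Fin k → Fin n) → Increasing g → (x : Fin n) → (∀ i → x ≢ g i) →
  Σ (Fin (suc k) → Fin n) λ f → Increasing f ×
    Σ (Fin (suc k)) λ r → f r ≡ x × (∀ i → f (punchIn r i) ≡ g i)
insert {zero} g _ x _ = (λ _ → x) , (λ { zero zero () }) , zero , refl , (λ ())
insert {suc k} g g-inc x x≢g with <-cmp x (g zero)
... | tri< x<g₀ _ _ =
  x ◂ g , ◂-increasing (λ i → ℕₚ.<-≤-trans x<g₀ (increasing⇒monotone g-inc z≤n)) g-inc ,
  zero , refl , (λ _ → refl)
... | tri≈ _ x≡g₀ _ = ⊥-elim (x≢g zero x≡g₀)
... | tri> _ _ g₀<x with insert (g ∘ suc) (λ i j i<j → g-inc (suc i) (suc j) (s≤s i<j)) x (x≢g ∘ suc)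
...   | f , f-inc , r , fr≡x , f-punchIn =
  g zero ◂ f , ◂-increasing g₀<f f-inc , suc r , fr≡x , agrees
  where
  -- every value of f is x or a later entry of g, hence above g zero
  g₀<f : ∀ i → g zero <ᶠ f i
  g₀<f i with r ≟ i
  ... | yes refl = subst (g zero <ᶠ_) (sym fr≡x) g₀<x
  ... | no r≢i = subst (g zero <ᶠ_) (trans (sym (f-punchIn (punchOut r≢i))) (cong f (punchIn-punchOut r≢i)))
                       (g-inc zero (suc (punchOut r≢i)) (s≤s z≤n))
  agrees : ∀ i → (g zero ◂ f) (punchIn (suc r) i) ≡ g i
  agrees zero    = refl
  agrees (suc i) = f-punchIn i

injective⇒surjective : ∀ {m} {τ : Fin m → Fin m} → Injective _≡_ _≡_ τ → ∀ r → ∃ λ a → τ a ≡ r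
injective⇒surjective {suc m} {τ} τ-inj r with any? (λ a → τ a ≟ r)
... | yes hit = hit
... | no miss = ⊥-elim (ℕₚ.<-irrefl refl (injective⇒≤ {f = squeeze} squeeze-inj))
  where
  r≢τ : ∀ a → r ≢ τ a
  r≢τ a r≡τa = miss (a , sym r≡τa)
  -- τ avoids r, so it factors through Fin m, injectively
  squeeze : Fin (suc m) → Fin m
  squeeze a = punchOut (r≢τ a)
  squeeze-inj : Injective _≡_ _≡_ squeeze
  squeeze-inj e = τ-inj (punchOut-injective (r≢τ _) (r≢τ _) e)

punchOut-above : ∀ {k} {j b : Fin (suc k)} (j≢b : j ≢ b) → j <ᶠ b → toℕ j ≤ toℕ (punchOut j≢b)
punchOut-above {_}     {zero}  {suc _} _   _         = z≤n
punchOut-above {suc _} {suc j} {suc b} j≢b (s≤s j<b) = s≤s (punchOut-above (j≢b ∘ cong suc) j<b)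

punchOut-below : ∀ {k} {j a : Fin (suc k)} (j≢a : j ≢ a) → a <ᶠ j → toℕ (punchOut j≢a) ≡ toℕ a
punchOut-below {suc _} {suc _} {zero}  _   _         = refl
punchOut-below {suc _} {suc j} {suc a} j≢a (s≤s a<j) = cong suc (punchOut-below (j≢a ∘ cong suc) a<j)

punchOut-increasing : ∀ {k} {j a b : Fin (suc k)} (j≢a : j ≢ a) (j≢b : j ≢ b) →
  a <ᶠ b → punchOut j≢a <ᶠ punchOut j≢b
punchOut-increasing j≢a j≢b a<b with ℕₚ.m≤n⇒m<n∨m≡n (punchOut-mono-≤ j≢a j≢b (ℕₚ.<⇒≤ a<b))
... | inj₁ lt = lt
... | inj₂ eq = ⊥-elim (ℕₚ.<-irrefl (cong toℕ (punchOut-injective j≢a j≢b (toℕ-injective eq))) a<b)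

Gap : ∀ {k L} (p : Fin (suc k) → Fin L) → Fin k → (Fin L → Set) → Set
Gap p γ Q = ∃ λ l → p (inject₁ γ) <ᶠ l × l <ᶠ p (suc γ) × Q l

interleave : ∀ {k L} (p : Fin (suc k) → Fin L) → Increasing p →
  (j : Fin (suc k)) (Q : Fin (suc k) → Fin L → Set) → Q j (p j) →
  (∀ a (j≢a : j ≢ a) → Gap p (punchOut j≢a) (Q a)) →
  Σ (Fin (suc k) → Fin L) λ ι → Increasing ι × (∀ a → Q a (ι a))
interleave {k} {L} p p-inc j Q Q-pj gap = ι , ι-inc , ι-ok
  where
  ι : Fin (suc k) → Fin L
  ι a with j ≟ a
  ... | yes _   = p j
  ... | no j≢a  = proj₁ (gap a j≢a)

  ι-ok : ∀ a → Q a (ι a)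
  ι-ok a with j ≟ a
  ... | yes refl = Q-pj
  ... | no j≢a   = proj₂ (proj₂ (proj₂ (gap a j≢a)))

  p-mono : ∀ {i i′} → toℕ i ≤ toℕ i′ → toℕ (p i) ≤ toℕ (p i′)
  p-mono = increasing⇒monotone p-inc

  ι-inc : Increasing ι
  ι-inc a b a<b with j ≟ a | j ≟ b
  ... | yes refl | yes refl = ⊥-elim (ℕₚ.<-irrefl refl a<b)
  ... | yes refl | no j≢b with gap b j≢b
  ...   | _ , above , _ , _ =
    ℕₚ.≤-<-trans (p-mono (subst (toℕ j ≤_) (sym (toℕ-inject₁ _)) (punchOut-above j≢b a<b))) above
  ι-inc a b a<b | no j≢a | yes refl with gap a j≢a
  ...   | _ , _ , below , _ =
    ℕₚ.<-≤-trans below (p-mono (subst (λ t → suc t ≤ toℕ j) (sym (punchOut-below j≢a a<b)) a<b))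
  ι-inc a b a<b | no j≢a | no j≢b with gap a j≢a | gap b j≢b
  ...   | _ , _ , below , _ | _ , above , _ , _ =
    ℕₚ.<-trans (ℕₚ.<-≤-trans below (p-mono gaps-ordered)) above
    where
    gaps-ordered : suc (toℕ (punchOut j≢a)) ≤ toℕ (inject₁ (punchOut j≢b))
    gaps-ordered = subst (suc (toℕ (punchOut j≢a)) ≤_) (sym (toℕ-inject₁ _))
                         (punchOut-increasing j≢a j≢b a<b)

many-occurrences⇒contains : ∀ {k n} (τ : Fin (suc k) → Fin (suc k)) → IsPermutation τ →
  (G : Graph n) (x : Fin n) → k ≤ degree G x →
  (w : Word n) → Represents w G → suc k ≤ occ x w → Contains w τ
many-occurrences⇒contains {k} τ τ-inj G x k≤deg w rep k<occ
  with select (_≟ x) w k<occ | neighbours G x k≤deg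
... | p , p-inc , p-x | g , g-inc , g-adj
  with insert g g-inc x (λ i → neighbour≢ G (g-adj i))
... | f , f-inc , r , fr≡x , f-punchIn
  with injective⇒surjective τ-inj r
... | j , τj≡r
  with interleave p p-inc j (λ a l → lookup w l ≡ f (τ a)) (trans (p-x j) (sym (trans (cong f τj≡r) fr≡x))) gap
  where
  neighbour : ∀ a → j ≢ a → Edge G x (f (τ a))
  neighbour a j≢a = subst (Edge G x) (sym (trans (cong f (sym (punchIn-punchOut r≢τa))) (f-punchIn _))) (g-adj _)
    where
    r≢τa : r ≢ τ a
    r≢τa r≡τa = j≢a (τ-inj (trans τj≡r r≡τa))
  gap : ∀ a (j≢a : j ≢ a) → Gap p (punchOut j≢a) (λ l → lookup w l ≡ f (τ a))
  gap a j≢a = proj₁ (Equivalence.from (rep x (f (τ a)) (neighbour≢ G edge)) edge)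
                (p (inject₁ γ)) (p (suc γ)) (p-inc _ _ consecutive) (p-x _) (p-x _)
    where
    edge : Edge G x (f (τ a))
    edge = neighbour a j≢a
    γ : Fin k
    γ = punchOut j≢a
    consecutive : inject₁ γ <ᶠ suc γ
    consecutive = subst (_< suc (toℕ γ)) (sym (toℕ-inject₁ γ)) (ℕₚ.n<1+n _)
... | ι , ι-inc , ι-letter = ι , ι-inc , order-iso
  where
  order-iso : ∀ a b → (lookup w (ι a) <ᶠ lookup w (ι b)) ⇔ (τ a <ᶠ τ b)
  order-iso a b = subst₂ (λ u v → (u <ᶠ v) ⇔ (τ a <ᶠ τ b)) (sym (ι-letter a)) (sym (ι-letter b))
                         (mk⇔ (increasing-reflects f-inc) (f-inc _ _))

-- Theorem 3.1: if w had more than k occurrences of x it would contain τ.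
theorem3p1 : (k : ℕ) → 1 ≤ k → (τ : Fin (suc k) → Fin (suc k)) → IsPermutation τ →
    (n : ℕ) (G : Graph n) → (∃ λ (w₀ : Word n) → Represents w₀ G × Avoids w₀ τ) →
    (x : Fin n) → k ≤ degree G x →
    (w : Word n) → Represents w G → Avoids w τ → occ x w ≤ k
theorem3p1 k _ τ τ-inj n G _ x k≤deg w rep avoids with occ x w ℕₚ.≤? k
... | yes occ≤k = occ≤k
... | no occ≰k = ⊥-elim (avoids (many-occurrences⇒contains τ τ-inj G x k≤deg w rep (ℕₚ.≰⇒> occ≰k)))
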